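{- Let $N$ be a binary nearly stable phylogenetic network, and let $U_{\mathrm{ret}}(N)$ (resp. $S_{\mathrm{ret}}(N)$) denote the number of unstable (resp. stable) reticulations of $N$. Then $U_{\mathrm{ret}}(N) \le 2\, S_{\mathrm{ret}}(N)$.
   Context: A phylogenetic network on a finite set $X$ of taxa is a directed acyclic graph with a single root (indegree $0$) such that its leaves (outdegree $0$) are in one-to-one correspondence with $X$, there is no vertex with both indegree one and outdegree one, and every vertex is reachable from the root. A reticulation is a vertex of indegree at least two and outdegree one; a tree vertex is a vertex of indegree one and outdegree at least two. The network is binary if the root has degree $2$, leaves have degree $1$, and all other vertices have degree $3$. A vertex $x$ is a stable ancestor of a vertex $v$ if $x$ lies on every directed path from the root to $v$; $x$ is stable if it is a stable ancestor of some leaf, and unstable otherwise. A network is nearly stable if for every vertex $v$, either $v$ is stable or all parents of $v$ are stable. -}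

module Defs where

open import Data.Nat using (ℕ; zero; suc; _+_; _*_; _≤_)
open import Data.Bool using (Bool; true; false; if_then_else_)
open import Data.Fin using (Fin)
import Data.Fin as F
open import Data.Fin.Subset using (Subset; _∈_; ∣_∣)
open import Data.List using (List; []; _∷_)
import Data.List.Membership.Propositional as LM
open import Data.Product using (Σ; ∃; _×_; _,_)
open import Data.Sum using (_⊎_)
open import Data.Empty using (⊥)
open import Relation.Nullary using (¬_)
open import Relation.Binary.PropositionalEquality using (_≡_)
open import Function using (_⇔_)

count : ∀ {n} → (Fin n → Bool) → ℕ
count {zero}  f = 0
count {suc n} f = (if f F.zero then 1 else 0) + count (λ i → f (F.suc i))

Digraph : ℕ → Set
Digraph n = Fin n → Fin n → Bool

module _ {n : ℕ} (E : Digraph n) where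

  indeg : Fin n → ℕ
  indeg v = count (λ u → E u v)

  outdeg : Fin n → ℕ
  outdeg v = count (λ w → E v w)

  data Path : Fin n → Fin n → Set where
    [] : ∀ v → Path v v
    _∷_ : ∀ {u w v} → E u w ≡ true → Path w v → Path u v

  verts : ∀ {u v} → Path u v → List (Fin n)
  verts ([] v) = v ∷ []
  verts (_∷_ {u} _ p) = u ∷ verts p

  Acyclic : Set
  Acyclic = ∀ {u w} → E u w ≡ true → ¬ Path w u

-- Phylogenetic network (the leaf set is identified with the taxa set X)
record PhyloNetwork : Set where
  field
    n      : ℕ
    E      : Digraph n
    root   : Fin n
    acyclic     : Acyclic E
    root-indeg  : indeg E root ≡ 0
    root-unique : ∀ v → indeg E v ≡ 0 → v ≡ root
    reachable   : ∀ v → Path E root v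
    no-deg-1-1  : ∀ v → indeg E v ≡ 1 → outdeg E v ≡ 1 → ⊥

module _ (N : PhyloNetwork) where
  open PhyloNetwork N

  Leaf : Fin n → Set
  Leaf v = outdeg E v ≡ 0

  Reticulation : Fin n → Set
  Reticulation v = (2 ≤ indeg E v) × outdeg E v ≡ 1

  Binary : Set
  Binary = (outdeg E root ≡ 2)
         × (∀ v → Leaf v → indeg E v ≡ 1)
         × (∀ v → ¬ v ≡ root → ¬ Leaf v → indeg E v + outdeg E v ≡ 3)

  StableAncestor : Fin n → Fin n → Set
  StableAncestor x v = (p : Path E root v) → x LM.∈ verts E p

  Stable : Fin n → Set
  Stable x = Σ (Fin n) λ l → Leaf l × StableAncestor x l

  Unstable : Fin n → Set
  Unstable x = ¬ Stable x

  NearlyStable : Set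
  NearlyStable = ∀ v → Stable v ⊎ (∀ u → E u v ≡ true → Stable u)

-- An unstable reticulation u has a unique child w. By near stability w is stable, and w is
-- itself a reticulation: were u the only parent of w, u would lie on every root path through w
-- and inherit its stability. So every unstable reticulation is a parent of a stable
-- reticulation, and in a binary network a reticulation has only two parents; double counting
-- the arcs from unstable to stable reticulations gives the bound.
module Submission where

open import Defs
open import Data.Nat using (ℕ; zero; suc; _+_; _*_; _≤_; _<_; z≤n; s≤s; s≤s⁻¹)
open import Data.Nat.Properties
open import Data.Bool using (Bool; true; false; if_then_else_; _∧_)
open import Data.Fin using (Fin)
import Data.Fin as F
import Data.Fin.Properties as FP
open import Data.Fin.Subset using (Subset; _∈_; ∣_∣)
import Data.Vec as V
open import Data.Vec.Properties using ([]=⇒lookup; lookup⇒[]=)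
import Data.List.Membership.Propositional as LM
open import Data.List.Relation.Unary.Any using (here; there)
open import Data.Product using (_×_; _,_; proj₁; ∃-syntax)
open import Data.Sum using (inj₁; inj₂)
open import Relation.Nullary using (¬_; yes; no; contradiction)
open import Relation.Binary.PropositionalEquality
open import Function using (_⇔_; Equivalence)
open import Algebra.Properties.CommutativeMonoid.Sum +-0-commutativeMonoid
  using (sum; sum-syntax; ∑-comm; sum-replicate-zero)
open import Algebra.Properties.Semiring.Sum +-*-semiring using (*-distribˡ-sum)

indicator : Bool → ℕ
indicator b = if b then 1 else 0

count≡∑indicator : ∀ {n} (f : Fin n → Bool) → count f ≡ ∑[ i < n ] indicator (f i)
count≡∑indicator {zero}  f = refl
count≡∑indicator {suc n} f = cong (indicator (f F.zero) +_) (count≡∑indicator (λ i → f (F.suc i)))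

∣p∣≡count-lookup : ∀ {n} (p : Subset n) → ∣ p ∣ ≡ count (V.lookup p)
∣p∣≡count-lookup V.[]           = refl
∣p∣≡count-lookup (true  V.∷ p) = cong suc (∣p∣≡count-lookup p)
∣p∣≡count-lookup (false V.∷ p) = ∣p∣≡count-lookup p

sum-mono-≤ : ∀ {n} {f g : Fin n → ℕ} → (∀ i → f i ≤ g i) → sum f ≤ sum g
sum-mono-≤ {zero}  f≤g = z≤n
sum-mono-≤ {suc n} f≤g = +-mono-≤ (f≤g F.zero) (sum-mono-≤ (λ i → f≤g (F.suc i)))

count-mono : ∀ {n} {f g : Fin n → Bool} → (∀ i → f i ≡ true → g i ≡ true) → count f ≤ count g
count-mono {zero}  f⇒g = z≤n
count-mono {suc n} {f} {g} f⇒g =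
  +-mono-≤ (indicator-mono (f F.zero) (f⇒g F.zero)) (count-mono (λ i → f⇒g (F.suc i)))
  where
  indicator-mono : ∀ a {b} → (a ≡ true → b ≡ true) → indicator a ≤ indicator b
  indicator-mono false a⇒b = z≤n
  indicator-mono true  a⇒b rewrite a⇒b refl = ≤-refl

f≡true⇒0<count : ∀ {n} (f : Fin n → Bool) i → f i ≡ true → 0 < count f
f≡true⇒0<count f F.zero    fi rewrite fi = s≤s z≤n
f≡true⇒0<count f (F.suc i) fi = ≤-trans (f≡true⇒0<count _ i fi) (m≤n+m _ _)

0<count⇒∃f≡true : ∀ {n} (f : Fin n → Bool) → 0 < count f → ∃[ i ] f i ≡ true
0<count⇒∃f≡true {suc n} f pos with f F.zero in f0
... | true  = F.zero , f0
... | false with 0<count⇒∃f≡true (λ i → f (F.suc i)) pos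
...   | i , fi = F.suc i , fi

count≤1⇒unique : ∀ {n} (f : Fin n → Bool) → count f ≤ 1 →
  ∀ {i j} → f i ≡ true → f j ≡ true → i ≡ j
count≤1⇒unique f c {F.zero}  {F.zero}  fi fj = refl
count≤1⇒unique f c {F.zero}  {F.suc j} fi fj rewrite fi =
  contradiction (≤-trans (f≡true⇒0<count _ j fj) (s≤s⁻¹ c)) λ ()
count≤1⇒unique f c {F.suc i} {F.zero}  fi fj rewrite fj =
  contradiction (≤-trans (f≡true⇒0<count _ i fi) (s≤s⁻¹ c)) λ ()
count≤1⇒unique f c {F.suc i} {F.suc j} fi fj =
  cong F.suc (count≤1⇒unique (λ i → f (F.suc i)) (m+n≤o⇒n≤o (indicator (f F.zero)) c) fi fj)

count-≤-by-double-counting : ∀ {m n} (R : Fin m → Fin n → Bool) (P : Fin m → Bool)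
  (Q : Fin n → Bool) k →
  (∀ i → P i ≡ true → ∃[ j ] R i j ≡ true × Q j ≡ true) →
  (∀ j → Q j ≡ true → count (λ i → R i j) ≤ k) →
  count P ≤ k * count Q
count-≤-by-double-counting {m} {n} R P Q k out-P in-Q = begin
  count P                                                 ≡⟨ count≡∑indicator P ⟩
  ∑[ i < m ] indicator (P i)                              ≤⟨ sum-mono-≤ row ⟩
  ∑[ i < m ] ∑[ j < n ] indicator (Q j ∧ R i j)          ≡⟨ ∑-comm (λ i j → indicator (Q j ∧ R i j)) ⟩
  ∑[ j < n ] ∑[ i < m ] indicator (Q j ∧ R i j)          ≤⟨ sum-mono-≤ column ⟩
  ∑[ j < n ] (k * indicator (Q j))                        ≡⟨ *-distribˡ-sum k (λ j → indicator (Q j)) ⟨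
  k * ∑[ j < n ] indicator (Q j)                          ≡⟨ cong (k *_) (count≡∑indicator Q) ⟨
  k * count Q                                             ∎
  where
  open ≤-Reasoning

  row : ∀ i → indicator (P i) ≤ ∑[ j < n ] indicator (Q j ∧ R i j)
  row i with P i in Pi
  ... | false = z≤n
  ... | true with out-P i Pi
  ...   | j , Rij , Qj = begin
    1                                       ≤⟨ f≡true⇒0<count (λ j → Q j ∧ R i j) j (cong₂ _∧_ Qj Rij) ⟩
    count (λ j → Q j ∧ R i j)               ≡⟨ count≡∑indicator (λ j → Q j ∧ R i j) ⟩
    ∑[ j < n ] indicator (Q j ∧ R i j)      ∎

  column : ∀ j → ∑[ i < m ] indicator (Q j ∧ R i j) ≤ k * indicator (Q j)
  column j with Q j in Qj
  ... | false = ≤-trans (≤-reflexive (sum-replicate-zero m)) z≤n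
  ... | true  = begin
    ∑[ i < m ] indicator (R i j)   ≡⟨ count≡∑indicator (λ i → R i j) ⟨
    count (λ i → R i j)            ≤⟨ in-Q j Qj ⟩
    k                              ≡⟨ *-identityʳ k ⟨
    k * 1                          ∎

∈-verts⇒parent-∈-verts : ∀ {n} {E : Digraph n} {a b w} (p : Path E a b) →
  w LM.∈ verts E p → ¬ w ≡ a → ∃[ x ] E x w ≡ true × x LM.∈ verts E p
∈-verts⇒parent-∈-verts ([] v) (here w≡v) w≢v = contradiction w≡v w≢v
∈-verts⇒parent-∈-verts (e ∷ p) (here w≡a) w≢a = contradiction w≡a w≢a
∈-verts⇒parent-∈-verts {a = a} {w = w} (_∷_ {w = c} e p) (there w∈p) _ with w FP.≟ c
... | yes refl = a , e , here refl
... | no  w≢c with ∈-verts⇒parent-∈-verts p w∈p w≢c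
...   | x , ex , x∈p = x , ex , there x∈p

module _ (N : PhyloNetwork) where
  open PhyloNetwork N

  0<indeg⇒≢root : ∀ {v} → 0 < indeg E v → ¬ v ≡ root
  0<indeg⇒≢root 0<indeg refl = contradiction (subst (0 <_) root-indeg 0<indeg) λ ()

  parent⇒≢root : ∀ {u w} → E u w ≡ true → ¬ w ≡ root
  parent⇒≢root {u} {w} e = 0<indeg⇒≢root (f≡true⇒0<count (λ x → E x w) u e)

  sole-parent-of-stable-is-stable : ∀ {u w} → E u w ≡ true → indeg E w ≤ 1 →
    Stable N w → Stable N u
  sole-parent-of-stable-is-stable {u} {w} e indeg≤1 (l , leaf , w-on-paths) =
    l , leaf , u-on-paths
    where
    u-on-paths : StableAncestor N u l
    u-on-paths p with ∈-verts⇒parent-∈-verts p (w-on-paths p) (parent⇒≢root e)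
    ... | x , ex , x∈p = subst (LM._∈ verts E p) (count≤1⇒unique (λ y → E y w) indeg≤1 ex e) x∈p

  child-of-unstable-is-stable : NearlyStable N → ∀ {u w} → E u w ≡ true →
    Unstable N u → Stable N w
  child-of-unstable-is-stable nearly-stable {u} {w} e u-unstable with nearly-stable w
  ... | inj₁ w-stable       = w-stable
  ... | inj₂ parents-stable = contradiction (parents-stable u e) u-unstable

  reticulation-indeg≤2 : Binary N → ∀ {v} → Reticulation N v → indeg E v ≤ 2
  reticulation-indeg≤2 (_ , _ , degree-three) {v} (2≤indeg , outdeg≡1) =
    ≤-reflexive (+-cancelʳ-≡ 1 (indeg E v) 2 indeg+1≡3)
    where
    indeg+1≡3 : indeg E v + 1 ≡ 3
    indeg+1≡3 = subst (λ o → indeg E v + o ≡ 3) outdeg≡1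
      (degree-three v (0<indeg⇒≢root (≤-trans (s≤s z≤n) 2≤indeg))
                      (λ leaf → contradiction (trans (sym outdeg≡1) leaf) λ ()))

  indeg≥2⇒reticulation : Binary N → ∀ {v} → 2 ≤ indeg E v → Reticulation N v
  indeg≥2⇒reticulation (_ , leaf-indeg , degree-three) {v} 2≤indeg = 2≤indeg , outdeg≡1
    where
    not-leaf : ¬ Leaf N v
    not-leaf leaf = contradiction (subst (2 ≤_) (leaf-indeg v leaf) 2≤indeg) λ { (s≤s ()) }

    outdeg≤1 : outdeg E v ≤ 1
    outdeg≤1 = s≤s⁻¹ (s≤s⁻¹ (subst (2 + outdeg E v ≤_)
      (degree-three v (0<indeg⇒≢root (≤-trans (s≤s z≤n) 2≤indeg)) not-leaf)
      (+-monoˡ-≤ (outdeg E v) 2≤indeg)))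

    outdeg≡1 : outdeg E v ≡ 1
    outdeg≡1 with outdeg E v in eq | outdeg≤1
    ... | zero  | _       = contradiction eq not-leaf
    ... | suc zero | _    = refl
    ... | suc (suc _) | s≤s ()

  child-of-unstable-is-reticulation : Binary N → NearlyStable N → ∀ {u w} → E u w ≡ true →
    Unstable N u → Reticulation N w
  child-of-unstable-is-reticulation binary nearly-stable {u} {w} e u-unstable
    with indeg E w ≤? 1
  ... | yes indeg≤1 = contradiction
    (sole-parent-of-stable-is-stable e indeg≤1 (child-of-unstable-is-stable nearly-stable e u-unstable))
    u-unstable
  ... | no  indeg≰1 = indeg≥2⇒reticulation binary (≰⇒> indeg≰1)

  unstable-reticulation-has-stable-reticulation-child : Binary N → NearlyStable N →
    ∀ {u} → Reticulation N u → Unstable N u →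
    ∃[ w ] E u w ≡ true × (Reticulation N w × Stable N w)
  unstable-reticulation-has-stable-reticulation-child binary nearly-stable {u} (_ , outdeg≡1) u-unstable
    with 0<count⇒∃f≡true (E u) (subst (0 <_) (sym outdeg≡1) (s≤s z≤n))
  ... | w , e = w , e , child-of-unstable-is-reticulation binary nearly-stable e u-unstable
                      , child-of-unstable-is-stable nearly-stable e u-unstable

lemma3 : (N : PhyloNetwork) → Binary N → NearlyStable N →
    (U S : Subset (PhyloNetwork.n N)) →
    (∀ v → (v ∈ U) ⇔ (Reticulation N v × Unstable N v)) →
    (∀ v → (v ∈ S) ⇔ (Reticulation N v × Stable N v)) →
    ∣ U ∣ ≤ 2 * ∣ S ∣
lemma3 N binary nearly-stable U S U⇔ S⇔ = begin
  ∣ U ∣                    ≡⟨ ∣p∣≡count-lookup U ⟩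
  count (V.lookup U)       ≤⟨ count-≤-by-double-counting E (V.lookup U) (V.lookup S) 2 out-of-U into-S ⟩
  2 * count (V.lookup S)   ≡⟨ cong (2 *_) (∣p∣≡count-lookup S) ⟨
  2 * ∣ S ∣                ∎
  where
  open ≤-Reasoning
  open PhyloNetwork N

  out-of-U : ∀ u → V.lookup U u ≡ true → ∃[ w ] E u w ≡ true × V.lookup S w ≡ true
  out-of-U u u∈U with Equivalence.to (U⇔ u) (lookup⇒[]= u U u∈U)
  ... | u-reticulation , u-unstable
    with unstable-reticulation-has-stable-reticulation-child N binary nearly-stable u-reticulation u-unstable
  ... | w , e , w-stable-reticulation = w , e , []=⇒lookup (Equivalence.from (S⇔ w) w-stable-reticulation)

  into-S : ∀ w → V.lookup S w ≡ true → indeg E w ≤ 2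
  into-S w w∈S = reticulation-indeg≤2 N binary (proj₁ (Equivalence.to (S⇔ w) (lookup⇒[]= w S w∈S)))
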